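{- Let $G$ be a (finite, simple) graph on $n$ vertices and suppose some vertex $v\in V(G)$ has $\deg_G(v)=k$. Then \[ \partial(G)+\partial(\bar{G})\le 2^{n+1}-2^{k}-2^{n-k-1}. \]
   Context: A dominating set in a graph $G$ is a set $S$ of vertices such that every vertex of $G$ is either in $S$ or adjacent to a vertex of $S$. $\partial(G)$ denotes the number of dominating sets of $G$, and $\bar{G}$ denotes the complement of $G$. -}

module Defs where

open import Data.Nat using (ℕ; zero; suc)
open import Data.Bool using (Bool; true; false; not; _∧_; _∨_; if_then_else_)
open import Data.Fin using (Fin)
open import Data.Vec using (Vec; []; _∷_; lookup)
open import Data.List using (List; []; _∷_; map; _++_; length; filter; allFin)
open import Data.List as L using ()
open import Relation.Binary.PropositionalEquality using (_≡_)
open import Relation.Nullary.Decidable using (Dec)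
open import Data.Bool using (T; T?)

record Graph (n : ℕ) : Set where
  field
    adj   : Fin n → Fin n → Bool
    sym   : ∀ u v → adj u v ≡ adj v u
    irrefl : ∀ v → adj v v ≡ false

open Graph public

eqFin : ∀ {n} → Fin n → Fin n → Bool
eqFin Fin.zero Fin.zero = true
eqFin Fin.zero (Fin.suc _) = false
eqFin (Fin.suc _) Fin.zero = false
eqFin (Fin.suc u) (Fin.suc v) = eqFin u v

private
  eqFin-sym : ∀ {n} (u v : Fin n) → eqFin u v ≡ eqFin v u
  eqFin-sym Fin.zero Fin.zero = _≡_.refl
  eqFin-sym Fin.zero (Fin.suc _) = _≡_.refl
  eqFin-sym (Fin.suc _) Fin.zero = _≡_.refl
  eqFin-sym (Fin.suc u) (Fin.suc v) = eqFin-sym u v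

  eqFin-refl : ∀ {n} (v : Fin n) → eqFin v v ≡ true
  eqFin-refl Fin.zero = _≡_.refl
  eqFin-refl (Fin.suc v) = eqFin-refl v

open import Relation.Binary.PropositionalEquality using (cong₂; cong)

complement : ∀ {n} → Graph n → Graph n
complement G = record
  { adj = λ u v → not (eqFin u v ∨ adj G u v)
  ; sym = λ u v → cong not (cong₂ _∨_ (eqFin-sym u v) (Graph.sym G u v))
  ; irrefl = λ v → cong (λ b → not (b ∨ adj G v v)) (eqFin-refl v)
  }

degree : ∀ {n} → Graph n → Fin n → ℕ
degree G v = length (filter (λ u → T? (adj G v u)) (allFin _))

VSet : ℕ → Set
VSet n = Vec Bool n

allVSets : (n : ℕ) → List (VSet n)
allVSets zero = [] ∷ []
allVSets (suc n) = map (true ∷_) (allVSets n) ++ map (false ∷_) (allVSets n)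

anyFin : (n : ℕ) → (Fin n → Bool) → Bool
anyFin zero p = false
anyFin (suc n) p = p Fin.zero ∨ anyFin n (λ i → p (Fin.suc i))

allFinB : (n : ℕ) → (Fin n → Bool) → Bool
allFinB zero p = true
allFinB (suc n) p = p Fin.zero ∧ allFinB n (λ i → p (Fin.suc i))

isDominating : ∀ {n} → Graph n → VSet n → Bool
isDominating {n} G S =
  allFinB n (λ v → lookup S v ∨ anyFin n (λ u → lookup S u ∧ adj G v u))

numDom : ∀ {n} → Graph n → ℕ
numDom {n} G = length (filter (λ S → T? (isDominating G S)) (allVSets n))

-- The closed neighbourhood of v splits the other n − 1 vertices into the k
-- neighbours and the n − k − 1 non-neighbours of v. No set of non-neighbours
-- of v dominates v, so at least 2^(n−k−1) of the 2^n vertex sets fail to dominate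
-- G. In the complement the roles swap: the non-neighbours of v in Ḡ are its k
-- neighbours in G, so at least 2^k sets fail to dominate Ḡ. Adding the two
-- bounds ∂(G) ≤ 2^n − 2^(n−k−1) and ∂(Ḡ) ≤ 2^n − 2^k gives the theorem.
module Submission where

open import Defs hiding (sym)
open import Data.Nat using (ℕ; zero; suc; _+_; _∸_; _^_; _≤_)
open import Data.Nat.Properties using (m≤m+n; +-comm; +-suc; +-identityʳ; m+n∸m≡n; +-mono-≤; module ≤-Reasoning)
open import Data.Nat.Tactic.RingSolver using (solve-∀)
open import Data.Bool using (Bool; true; false; not; _∧_; _∨_; if_then_else_)
open import Data.Bool.Properties using (not-involutive; ∨-conicalʳ)
open import Data.Fin using (Fin)
open import Data.Vec using (_∷_; lookup)
open import Data.List using (List; []; _∷_; map; _++_; length; filterᵇ; tabulate; allFin)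
open import Data.List.Properties using (length-++; length-map; length-tabulate; map-tabulate)
open import Function using (_∘_; id)
open import Relation.Binary.PropositionalEquality
  using (_≡_; refl; sym; trans; cong; cong₂; subst; module ≡-Reasoning)

private
  variable
    A B : Set
    n : ℕ

count : (A → Bool) → List A → ℕ
count p [] = 0
count p (x ∷ xs) = if p x then suc (count p xs) else count p xs

length-filterᵇ : (p : A → Bool) (xs : List A) → length (filterᵇ p xs) ≡ count p xs
length-filterᵇ p [] = refl
length-filterᵇ p (x ∷ xs) with p x
... | true = cong suc (length-filterᵇ p xs)
... | false = length-filterᵇ p xs

count-cong : {p q : A → Bool} (xs : List A) → (∀ x → p x ≡ q x) → count p xs ≡ count q xs
count-cong [] p≗q = refl
count-cong {q = q} (x ∷ xs) p≗q rewrite p≗q x with q x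
... | true = cong suc (count-cong xs p≗q)
... | false = count-cong xs p≗q

count-const-false : (xs : List A) → count (λ _ → false) xs ≡ 0
count-const-false [] = refl
count-const-false (x ∷ xs) = count-const-false xs

count-++ : (p : A → Bool) (xs ys : List A) → count p (xs ++ ys) ≡ count p xs + count p ys
count-++ p [] ys = refl
count-++ p (x ∷ xs) ys with p x
... | true = cong suc (count-++ p xs ys)
... | false = count-++ p xs ys

count-map : (p : B → Bool) (f : A → B) (xs : List A) → count p (map f xs) ≡ count (p ∘ f) xs
count-map p f [] = refl
count-map p f (x ∷ xs) with p (f x)
... | true = cong suc (count-map p f xs)
... | false = count-map p f xs

count+count-not : (p : A → Bool) (xs : List A) → count p xs + count (not ∘ p) xs ≡ length xs
count+count-not p [] = refl
count+count-not p (x ∷ xs) with p x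
... | true = cong suc (count+count-not p xs)
... | false = trans (+-suc (count p xs) _) (cong suc (count+count-not p xs))

count-∨-disjoint : (p q : A → Bool) (xs : List A) → (∀ x → p x ≡ true → q x ≡ false) →
  count (λ x → p x ∨ q x) xs ≡ count p xs + count q xs
count-∨-disjoint p q [] disjoint = refl
count-∨-disjoint p q (x ∷ xs) disjoint with p x in px | q x in qx
... | true | true with () ← trans (sym qx) (disjoint x px)
... | true | false = cong suc (count-∨-disjoint p q xs disjoint)
... | false | true = trans (cong suc (count-∨-disjoint p q xs disjoint)) (sym (+-suc (count p xs) _))
... | false | false = count-∨-disjoint p q xs disjoint

count+count≤length : (p q : A → Bool) (xs : List A) → (∀ x → p x ≡ true → q x ≡ false) →
  count p xs + count q xs ≤ length xs
count+count≤length p q xs disjoint = begin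
  count p xs + count q xs        ≡⟨ sym (count-∨-disjoint p q xs disjoint) ⟩
  count (λ x → p x ∨ q x) xs     ≤⟨ m≤m+n _ _ ⟩
  count (λ x → p x ∨ q x) xs + _ ≡⟨ count+count-not (λ x → p x ∨ q x) xs ⟩
  length xs                      ∎
  where open ≤-Reasoning

count-tabulate-suc : ∀ n (p : Fin (suc n) → Bool) → count p (tabulate Fin.suc) ≡ count (p ∘ Fin.suc) (allFin n)
count-tabulate-suc n p = trans (cong (count p) (sym (map-tabulate id Fin.suc))) (count-map p Fin.suc (allFin n))

eqFin-refl : (v : Fin n) → eqFin v v ≡ true
eqFin-refl Fin.zero = refl
eqFin-refl (Fin.suc v) = eqFin-refl v

eqFin⇒≡ : (u v : Fin n) → eqFin u v ≡ true → u ≡ v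
eqFin⇒≡ Fin.zero Fin.zero _ = refl
eqFin⇒≡ (Fin.suc u) (Fin.suc v) eq = cong Fin.suc (eqFin⇒≡ u v eq)

count-eqFin-allFin : (v : Fin n) → count (eqFin v) (allFin n) ≡ 1
count-eqFin-allFin {suc n} Fin.zero =
  cong suc (trans (count-tabulate-suc n (eqFin Fin.zero)) (count-const-false (allFin n)))
count-eqFin-allFin {suc n} (Fin.suc v) =
  trans (count-tabulate-suc n (eqFin (Fin.suc v))) (count-eqFin-allFin v)

allFinB⇒ : (p : Fin n → Bool) → allFinB n p ≡ true → ∀ i → p i ≡ true
allFinB⇒ p all Fin.zero with p Fin.zero | all
... | true | _ = refl
allFinB⇒ p all (Fin.suc i) with p Fin.zero | all
... | true | all′ = allFinB⇒ (p ∘ Fin.suc) all′ i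

allFinB-false : (p : Fin n → Bool) (i : Fin n) → p i ≡ false → allFinB n p ≡ false
allFinB-false p Fin.zero pi rewrite pi = refl
allFinB-false p (Fin.suc i) pi with p Fin.zero
... | true = allFinB-false (p ∘ Fin.suc) i pi
... | false = refl

anyFin-false : (p : Fin n → Bool) → (∀ i → p i ≡ false) → anyFin n p ≡ false
anyFin-false {zero} p none = refl
anyFin-false {suc n} p none rewrite none Fin.zero = anyFin-false (p ∘ Fin.suc) (none ∘ Fin.suc)

2^n+2^n≡2^suc[n] : ∀ n → 2 ^ n + 2 ^ n ≡ 2 ^ suc n
2^n+2^n≡2^suc[n] n = cong (2 ^ n +_) (sym (+-identityʳ (2 ^ n)))

length-allVSets : ∀ n → length (allVSets n) ≡ 2 ^ n
length-allVSets zero = refl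
length-allVSets (suc n) = begin
  length (map (true ∷_) (allVSets n) ++ map (false ∷_) (allVSets n))
    ≡⟨ length-++ (map (true ∷_) (allVSets n)) ⟩
  length (map (true ∷_) (allVSets n)) + length (map (false ∷_) (allVSets n))
    ≡⟨ cong₂ _+_ (length-map _ (allVSets n)) (length-map _ (allVSets n)) ⟩
  length (allVSets n) + length (allVSets n)
    ≡⟨ cong (λ m → m + m) (length-allVSets n) ⟩
  2 ^ n + 2 ^ n
    ≡⟨ 2^n+2^n≡2^suc[n] n ⟩
  2 ^ suc n ∎
  where open ≡-Reasoning

_⊆ᵇ_ : VSet n → (Fin n → Bool) → Bool
_⊆ᵇ_ {n} S p = allFinB n (λ u → not (lookup S u) ∨ p u)

count-⊆ᵇ : ∀ n (p : Fin n → Bool) → count (_⊆ᵇ p) (allVSets n) ≡ 2 ^ count p (allFin n)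
count-⊆ᵇ zero p = refl
count-⊆ᵇ (suc n) p = begin
  count (_⊆ᵇ p) (map (true ∷_) (allVSets n) ++ map (false ∷_) (allVSets n))
    ≡⟨ count-++ (_⊆ᵇ p) (map (true ∷_) (allVSets n)) _ ⟩
  count (_⊆ᵇ p) (map (true ∷_) (allVSets n)) + count (_⊆ᵇ p) (map (false ∷_) (allVSets n))
    ≡⟨ cong₂ _+_ (count-map (_⊆ᵇ p) (true ∷_) (allVSets n)) (count-map (_⊆ᵇ p) (false ∷_) (allVSets n)) ⟩
  count (λ S → p Fin.zero ∧ S ⊆ᵇ p′) (allVSets n) + count (_⊆ᵇ p′) (allVSets n)
    ≡⟨ split-on-head (p Fin.zero) refl ⟩
  2 ^ count p (allFin (suc n)) ∎
  where
  open ≡-Reasoning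
  p′ = p ∘ Fin.suc
  subsets′ = count-⊆ᵇ n p′
  split-on-head : (b : Bool) → p Fin.zero ≡ b →
    count (λ S → b ∧ S ⊆ᵇ p′) (allVSets n) + count (_⊆ᵇ p′) (allVSets n) ≡ 2 ^ count p (allFin (suc n))
  split-on-head true p0 rewrite p0 | count-tabulate-suc n p =
    trans (cong₂ _+_ subsets′ subsets′) (2^n+2^n≡2^suc[n] (count p′ (allFin n)))
  split-on-head false p0 rewrite p0 | count-tabulate-suc n p =
    trans (cong (_+ count (_⊆ᵇ p′) (allVSets n)) (count-const-false (allVSets n))) subsets′

degree≡count : (G : Graph n) (v : Fin n) → degree G v ≡ count (adj G v) (allFin n)
degree≡count {n} G v = length-filterᵇ (adj G v) (allFin n)

suc-degree+degree-complement : (G : Graph n) (v : Fin n) →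
  suc (degree G v + degree (complement G) v) ≡ n
suc-degree+degree-complement {n} G v = begin
  suc (degree G v + degree (complement G) v)
    ≡⟨ cong₂ (λ a b → suc (a + b)) (degree≡count G v) (degree≡count (complement G) v) ⟩
  1 + count (adj G v) (allFin n) + count (adj (complement G) v) (allFin n)
    ≡⟨ cong (λ m → m + count (adj G v) (allFin n) + count (adj (complement G) v) (allFin n)) (sym (count-eqFin-allFin v)) ⟩
  count (eqFin v) (allFin n) + count (adj G v) (allFin n) + count (adj (complement G) v) (allFin n)
    ≡⟨ cong (_+ count (adj (complement G) v) (allFin n)) (sym (count-∨-disjoint (eqFin v) (adj G v) (allFin n) loopless)) ⟩
  count (λ u → eqFin v u ∨ adj G v u) (allFin n) + count (adj (complement G) v) (allFin n)
    ≡⟨ count+count-not (λ u → eqFin v u ∨ adj G v u) (allFin n) ⟩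
  length (allFin n)
    ≡⟨ length-tabulate id ⟩
  n ∎
  where
  open ≡-Reasoning
  loopless : ∀ u → eqFin v u ≡ true → adj G v u ≡ false
  loopless u v≡u rewrite eqFin⇒≡ v u v≡u = irrefl G u

adj-complement-complement : (G : Graph n) (u v : Fin n) → adj (complement (complement G)) u v ≡ adj G u v
adj-complement-complement G u v with eqFin u v in u≡v
... | true rewrite eqFin⇒≡ u v u≡v = sym (irrefl G v)
... | false = not-involutive (adj G u v)

degree-complement-complement : (G : Graph n) (v : Fin n) → degree (complement (complement G)) v ≡ degree G v
degree-complement-complement {n} G v = begin
  degree (complement (complement G)) v               ≡⟨ degree≡count (complement (complement G)) v ⟩
  count (adj (complement (complement G)) v) (allFin n) ≡⟨ count-cong (allFin n) (adj-complement-complement G v) ⟩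
  count (adj G v) (allFin n)                         ≡⟨ degree≡count G v ⟨
  degree G v                                         ∎
  where open ≡-Reasoning

⊆-neighbourhood-complement⇒¬dominating : (G : Graph n) (v : Fin n) (S : VSet n) →
  S ⊆ᵇ adj (complement G) v ≡ true → isDominating G S ≡ false
⊆-neighbourhood-complement⇒¬dominating {n} G v S S⊆N̄ =
  allFinB-false _ v (cong₂ _∨_ v∉S (anyFin-false _ no-neighbour-in-S))
  where
  member⇒non-neighbour : ∀ u → lookup S u ≡ true → eqFin v u ∨ adj G v u ≡ false
  member⇒non-neighbour u u∈S with allFinB⇒ _ S⊆N̄ u
  ... | u∉S∨u∈N̄ rewrite u∈S with eqFin v u ∨ adj G v u
  ... | false = refl

  v∉S : lookup S v ≡ false
  v∉S with lookup S v in v∈S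
  ... | false = refl
  ... | true with () ← trans (sym (cong (_∨ adj G v v) (eqFin-refl v))) (member⇒non-neighbour v v∈S)

  no-neighbour-in-S : ∀ u → lookup S u ∧ adj G v u ≡ false
  no-neighbour-in-S u with lookup S u in u∈S
  ... | false = refl
  ... | true = ∨-conicalʳ (eqFin v u) (adj G v u) (member⇒non-neighbour u u∈S)

numDom+2^degree-complement≤2^n : (G : Graph n) (v : Fin n) →
  numDom G + 2 ^ degree (complement G) v ≤ 2 ^ n
numDom+2^degree-complement≤2^n {n} G v = begin
  numDom G + 2 ^ degree (complement G) v
    ≡⟨ cong₂ _+_ (length-filterᵇ (isDominating G) (allVSets n)) (cong (2 ^_) (degree≡count (complement G) v)) ⟩
  count (isDominating G) (allVSets n) + 2 ^ count (adj (complement G) v) (allFin n)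
    ≡⟨ cong (count (isDominating G) (allVSets n) +_) (count-⊆ᵇ n (adj (complement G) v)) ⟨
  count (isDominating G) (allVSets n) + count (_⊆ᵇ adj (complement G) v) (allVSets n)
    ≡⟨ +-comm (count (isDominating G) (allVSets n)) _ ⟩
  count (_⊆ᵇ adj (complement G) v) (allVSets n) + count (isDominating G) (allVSets n)
    ≤⟨ count+count≤length _ (isDominating G) (allVSets n) (⊆-neighbourhood-complement⇒¬dominating G v) ⟩
  length (allVSets n)
    ≡⟨ length-allVSets n ⟩
  2 ^ n ∎
  where open ≤-Reasoning

suc[m+n]∸m∸1≡n : ∀ m n → suc (m + n) ∸ m ∸ 1 ≡ n
suc[m+n]∸m∸1≡n m n = trans (cong (λ x → x ∸ m ∸ 1) (sym (+-suc m n))) (cong (_∸ 1) (m+n∸m≡n m (suc n)))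

lemma1 : (n k : ℕ) (G : Graph n) (v : Fin n) → degree G v ≡ k →
    numDom G + numDom (complement G) + 2 ^ k + 2 ^ (n ∸ k ∸ 1) ≤ 2 ^ (n + 1)
lemma1 n k G v refl = begin
  numDom G + numDom Ḡ + 2 ^ k + 2 ^ (n ∸ k ∸ 1) ≡⟨ cong (λ m → numDom G + numDom Ḡ + 2 ^ k + 2 ^ m) n∸k∸1≡k̄ ⟩
  numDom G + numDom Ḡ + 2 ^ k + 2 ^ k̄           ≡⟨ regroup (numDom G) (numDom Ḡ) (2 ^ k) (2 ^ k̄) ⟩
  (numDom G + 2 ^ k̄) + (numDom Ḡ + 2 ^ k)       ≤⟨ +-mono-≤ bound-G bound-Ḡ ⟩
  2 ^ n + 2 ^ n                                 ≡⟨ 2^n+2^n≡2^suc[n] n ⟩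
  2 ^ suc n                                     ≡⟨ cong (2 ^_) (+-comm 1 n) ⟩
  2 ^ (n + 1)                                   ∎
  where
  open ≤-Reasoning
  Ḡ = complement G
  k̄ = degree Ḡ v

  n∸k∸1≡k̄ : n ∸ k ∸ 1 ≡ k̄
  n∸k∸1≡k̄ = subst (λ m → m ∸ k ∸ 1 ≡ k̄) (suc-degree+degree-complement G v) (suc[m+n]∸m∸1≡n k k̄)

  bound-G : numDom G + 2 ^ k̄ ≤ 2 ^ n
  bound-G = numDom+2^degree-complement≤2^n G v

  bound-Ḡ : numDom Ḡ + 2 ^ k ≤ 2 ^ n
  bound-Ḡ = subst (λ d → numDom Ḡ + 2 ^ d ≤ 2 ^ n) (degree-complement-complement G v)
                  (numDom+2^degree-complement≤2^n Ḡ v)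

  regroup : ∀ a b c d → a + b + c + d ≡ (a + d) + (b + c)
  regroup = solve-∀
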